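{- Let $\Gamma\cup\{\alpha\}\subseteq For_0$ be such that $\Gamma\vDash_{\mathbf{CPL}}\alpha$. If $var(\Gamma)=var(\alpha)$, then $\Gamma\vDash_{\mathbf{B}_3}\alpha$ and $\Gamma\vDash_{\mathbf{H}_3}\alpha$.
   Context: Fix a denumerable set $prop$ of propositional variables. $For_0$ is the set of formulas built from $prop$ with unary $\lnot$ and binary $\vee,\wedge,\to$. $var(\alpha)$ is the set of propositional variables in $\alpha$; $var(\Gamma)=\bigcup_{\gamma\in\Gamma}var(\gamma)$. $\Gamma\vDash_{\mathbf{CPL}}\alpha$ means every classical two-valued valuation making all members of $\Gamma$ true makes $\alpha$ true. In both $\mathbf{B}_3$ and $\mathbf{H}_3$, valuations map $prop$ to $\{1,\tfrac12,0\}$ and extend to $For_0$ by: $\lnot1=0,\lnot\tfrac12=\tfrac12,\lnot0=1$; for each binary connective $\wedge,\vee,\to$, the value is $\tfrac12$ if either argument is $\tfrac12$, and otherwise is the classical truth function on $\{0,1\}$. (These coincide with evaluating $\alpha\vee\beta$ as $\lnot(\lnot\alpha\wedge\lnot\beta)$, $\alpha\to\beta$ as $\lnot(\alpha\wedge\lnot\beta)$ in Bochvar's $\{\lnot,\wedge\}$-language, and $\alpha\wedge\beta$ as $\lnot(\lnot\alpha\vee\lnot\beta)$, $\alpha\to\beta$ as $\lnot\alpha\vee\beta$ in Halldén's $\{\lnot,\vee\}$-language.) In $\mathbf{B}_3$ the designated set is $\{1\}$; in $\mathbf{H}_3$ it is $\{1,\tfrac12\}$. $\Gamma\vDash_{\mathbf{L}}\alpha$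 means every valuation giving designated values to all members of $\Gamma$ gives a designated value to $\alpha$. -}

module Defs where

open import Data.Nat using (ℕ)
open import Data.Bool using (Bool; true; false; not; _∧_; _∨_)
open import Data.Product using (Σ; _×_)
open import Relation.Binary.PropositionalEquality using (_≡_)
open import Function.Bundles using (_⇔_)

Prop : Set
Prop = ℕ

data For0 : Set where
  var  : Prop → For0
  ¬'_  : For0 → For0
  _∨'_ : For0 → For0 → For0
  _∧'_ : For0 → For0 → For0
  _⇒'_ : For0 → For0 → For0

data _∈var_ (p : Prop) : For0 → Set where
  here  : p ∈var var p
  neg   : ∀ {a} → p ∈var a → p ∈var (¬' a)
  orl   : ∀ {a b} → p ∈var a → p ∈var (a ∨' b)
  orr   : ∀ {a b} → p ∈var b → p ∈var (a ∨' b)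
  andl  : ∀ {a b} → p ∈var a → p ∈var (a ∧' b)
  andr  : ∀ {a b} → p ∈var b → p ∈var (a ∧' b)
  impl  : ∀ {a b} → p ∈var a → p ∈var (a ⇒' b)
  impr  : ∀ {a b} → p ∈var b → p ∈var (a ⇒' b)

FSet : Set₁
FSet = For0 → Set

_∈varS_ : Prop → FSet → Set
p ∈varS Γ = Σ For0 (λ γ → Γ γ × p ∈var γ)

SameVars : FSet → For0 → Set
SameVars Γ α = ∀ p → (p ∈varS Γ) ⇔ (p ∈var α)

evalC : (Prop → Bool) → For0 → Bool
evalC v (var p)  = v p
evalC v (¬' a)   = not (evalC v a)
evalC v (a ∨' b) = evalC v a ∨ evalC v b
evalC v (a ∧' b) = evalC v a ∧ evalC v b
evalC v (a ⇒' b) = not (evalC v a) ∨ evalC v b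

_⊨CPL_ : FSet → For0 → Set
Γ ⊨CPL α = ∀ (v : Prop → Bool) →
  (∀ γ → Γ γ → evalC v γ ≡ true) → evalC v α ≡ true

-- weak Kleene three values: one = 1, half = 1/2, zero = 0

data Three : Set where
  one half zero : Three

neg3 : Three → Three
neg3 one  = zero
neg3 half = half
neg3 zero = one

toB : Bool → Three
toB true  = one
toB false = zero

lift2 : (Bool → Bool → Bool) → Three → Three → Three
lift2 f half _    = half
lift2 f one  half = half
lift2 f zero half = half
lift2 f one  one  = toB (f true true)
lift2 f one  zero = toB (f true false)
lift2 f zero one  = toB (f false true)
lift2 f zero zero = toB (f false false)

eval3 : (Prop → Three) → For0 → Three
eval3 v (var p)  = v p
eval3 v (¬' a)   = neg3 (eval3 v a)
eval3 v (a ∨' b) = lift2 _∨_ (eval3 v a) (eval3 v b)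
eval3 v (a ∧' b) = lift2 _∧_ (eval3 v a) (eval3 v b)
eval3 v (a ⇒' b) = lift2 (λ x y → not x ∨ y) (eval3 v a) (eval3 v b)

DesB3 : Three → Set
DesB3 x = x ≡ one

data DesH3 : Three → Set where
  d1 : DesH3 one
  dh : DesH3 half

_⊨B3_ : FSet → For0 → Set
Γ ⊨B3 α = ∀ (v : Prop → Three) →
  (∀ γ → Γ γ → DesB3 (eval3 v γ)) → DesB3 (eval3 v α)

_⊨H3_ : FSet → For0 → Set
Γ ⊨H3 α = ∀ (v : Prop → Three) →
  (∀ γ → Γ γ → DesH3 (eval3 v γ)) → DesH3 (eval3 v α)

module Submission where

-- Weak Kleene connectives are "infectious": if some variable of
-- φ receives ½ then φ itself evaluates to ½.  Conversely, if no variable of φ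
-- receives ½ then φ is evaluated classically, under the two-valued valuation
-- "v p is 1".  A three-valued valuation that is classical on var(α) is, when
-- var(Γ) = var(α), also classical on every member of Γ (and vice versa), so
-- classical consequence transfers: if all γ ∈ Γ take value 1 then so does α.
--   * B₃: every premise has value 1, so (infectivity) no variable of var(Γ),
--     hence none of var(α), receives ½, and the transfer gives α = 1.
--   * H₃: if α = ½ it is designated; otherwise no variable of α receives ½,
--     hence none of var(Γ) does, so each designated premise is in fact 1,
--     and the transfer gives α = 1.
-- The file proves infectivity, classical agreement and the transfer lemma,
-- then derives the theorem.

open import Defs
open import Data.Bool using (Bool; true; false; not; _∨_; _∧_)
open import Data.Product using (_×_; _,_)
open import Data.Empty using (⊥-elim)
open import Function.Bundles using (Equivalence)
open import Relation.Nullary using (¬_)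
open import Relation.Binary.PropositionalEquality
  using (_≡_; refl; sym; trans; cong)

lift2-halfʳ : ∀ f x → lift2 f x half ≡ half
lift2-halfʳ f one  = refl
lift2-halfʳ f half = refl
lift2-halfʳ f zero = refl

infectious : ∀ v {p} φ → p ∈var φ → v p ≡ half → eval3 v φ ≡ half
infectious v (var p)  here     e = e
infectious v (¬' a)   (neg i)  e = cong neg3 (infectious v a i e)
infectious v (a ∨' b) (orl i)  e rewrite infectious v a i e = refl
infectious v (a ∨' b) (orr i)  e rewrite infectious v b i e = lift2-halfʳ _ (eval3 v a)
infectious v (a ∧' b) (andl i) e rewrite infectious v a i e = refl
infectious v (a ∧' b) (andr i) e rewrite infectious v b i e = lift2-halfʳ _ (eval3 v a)
infectious v (a ⇒' b) (impl i) e rewrite infectious v a i e = refl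
infectious v (a ⇒' b) (impr i) e rewrite infectious v b i e = lift2-halfʳ _ (eval3 v a)

Classical : (Prop → Three) → For0 → Set
Classical v φ = ∀ {p} → p ∈var φ → ¬ (v p ≡ half)

notHalf⇒classical : ∀ v φ → ¬ (eval3 v φ ≡ half) → Classical v φ
notHalf⇒classical v φ φ≢½ i e = φ≢½ (infectious v φ i e)

isOne : Three → Bool
isOne one  = true
isOne half = false
isOne zero = false

shadow : (Prop → Three) → Prop → Bool
shadow v p = isOne (v p)

notHalf⇒toB : ∀ x → ¬ (x ≡ half) → x ≡ toB (isOne x)
notHalf⇒toB one  _   = refl
notHalf⇒toB half x≢½ = ⊥-elim (x≢½ refl)
notHalf⇒toB zero _   = refl

neg3-toB : ∀ a → neg3 (toB a) ≡ toB (not a)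
neg3-toB true  = refl
neg3-toB false = refl

lift2-toB : ∀ f a b → lift2 f (toB a) (toB b) ≡ toB (f a b)
lift2-toB f true  true  = refl
lift2-toB f true  false = refl
lift2-toB f false true  = refl
lift2-toB f false false = refl

classicalAgreement : ∀ v φ → Classical v φ → eval3 v φ ≡ toB (evalC (shadow v) φ)
classicalAgreement v (var p)  c = notHalf⇒toB (v p) (c here)
classicalAgreement v (¬' a)   c
  rewrite classicalAgreement v a (λ i → c (neg i)) = neg3-toB _
classicalAgreement v (a ∨' b) c
  rewrite classicalAgreement v a (λ i → c (orl i))
        | classicalAgreement v b (λ i → c (orr i)) =
          lift2-toB _∨_ (evalC (shadow v) a) (evalC (shadow v) b)
classicalAgreement v (a ∧' b) c
  rewrite classicalAgreement v a (λ i → c (andl i))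
        | classicalAgreement v b (λ i → c (andr i)) =
          lift2-toB _∧_ (evalC (shadow v) a) (evalC (shadow v) b)
classicalAgreement v (a ⇒' b) c
  rewrite classicalAgreement v a (λ i → c (impl i))
        | classicalAgreement v b (λ i → c (impr i)) =
          lift2-toB (λ x y → not x ∨ y) (evalC (shadow v) a) (evalC (shadow v) b)

toB≢half : ∀ b → ¬ (toB b ≡ half)
toB≢half true  ()
toB≢half false ()

classical⇒notHalf : ∀ v φ → Classical v φ → ¬ (eval3 v φ ≡ half)
classical⇒notHalf v φ c e = toB≢half _ (trans (sym (classicalAgreement v φ c)) e)

toB-one⇒true : ∀ b → toB b ≡ one → b ≡ true
toB-one⇒true true  _ = refl
toB-one⇒true false ()

consequenceTransfer : ∀ (Γ : FSet) α v → Γ ⊨CPL α →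
  Classical v α → (∀ γ → Γ γ → Classical v γ) →
  (∀ γ → Γ γ → eval3 v γ ≡ one) → eval3 v α ≡ one
consequenceTransfer Γ α v cpl cα cΓ oneΓ =
  trans (classicalAgreement v α cα) (cong toB (cpl (shadow v) shadowSatisfiesΓ))
  where
  shadowSatisfiesΓ : ∀ γ → Γ γ → evalC (shadow v) γ ≡ true
  shadowSatisfiesΓ γ g =
    toB-one⇒true _ (trans (sym (classicalAgreement v γ (cΓ γ g))) (oneΓ γ g))

classicalΓ⇒α : ∀ Γ α v → SameVars Γ α →
  (∀ γ → Γ γ → Classical v γ) → Classical v α
classicalΓ⇒α Γ α v same cΓ {p} i with Equivalence.from (same p) i
... | γ , g , j = cΓ γ g j

classicalα⇒Γ : ∀ Γ α v → SameVars Γ α →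
  Classical v α → ∀ γ → Γ γ → Classical v γ
classicalα⇒Γ Γ α v same cα γ g {p} i = cα (Equivalence.to (same p) (γ , g , i))

one≢half : ¬ (one ≡ half)
one≢half ()

zero≢half : ¬ (zero ≡ half)
zero≢half ()

one≢zero : ¬ (one ≡ zero)
one≢zero ()

designatedNotHalf⇒one : ∀ {x} → DesH3 x → ¬ (x ≡ half) → x ≡ one
designatedNotHalf⇒one d1 _   = refl
designatedNotHalf⇒one dh ½≢½ = ⊥-elim (½≢½ refl)

mainTheorem8 : (Γ : FSet) (α : For0) → Γ ⊨CPL α → SameVars Γ α →
    (Γ ⊨B3 α) × (Γ ⊨H3 α)
mainTheorem8 Γ α cpl same = bochvar , hallden
  where
  bochvar : Γ ⊨B3 α
  bochvar v oneΓ = consequenceTransfer Γ α v cpl (classicalΓ⇒α Γ α v same cΓ) cΓ oneΓ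
    where
    cΓ : ∀ γ → Γ γ → Classical v γ
    cΓ γ g = notHalf⇒classical v γ (λ e → one≢half (trans (sym (oneΓ γ g)) e))

  hallden : Γ ⊨H3 α
  hallden v desΓ with eval3 v α in eα
  ... | one  = d1
  ... | half = dh
  ... | zero = ⊥-elim (one≢zero (trans (sym αIsOne) eα))
    where
    cα : Classical v α
    cα = notHalf⇒classical v α (λ e → zero≢half (trans (sym eα) e))
    cΓ : ∀ γ → Γ γ → Classical v γ
    cΓ = classicalα⇒Γ Γ α v same cα
    αIsOne : eval3 v α ≡ one
    αIsOne = consequenceTransfer Γ α v cpl cα cΓ λ γ g →
      designatedNotHalf⇒one (desΓ γ g) (classical⇒notHalf v γ (cΓ γ g))
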